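{- Let $S$ be the set of denominators of rational numbers in $(0,1)$ which have a continued fraction expansion $[0;a_1,\ldots,a_n]$ with all $a_i\in 4\mathbb{Z}^+=\{4,8,12,\ldots\}$. Let $\Psi_2=\left\langle\begin{pmatrix}1&4\\0&1\end{pmatrix},\begin{pmatrix}1&0\\4&1\end{pmatrix}\right\rangle^+$. Then $S$ is the union of the set of numerators and the set of denominators of the orbit $\Psi_2\begin{pmatrix}0\\1\end{pmatrix}$.
   Context: $\langle A_1,\dots,A_k\rangle^+$ is the monoid generated by the $A_i$ and the identity. The orbit $\Psi_2\begin{pmatrix}0\\1\end{pmatrix}$ is $\{\gamma\begin{pmatrix}0\\1\end{pmatrix}:\gamma\in\Psi_2\}$; first coordinates are numerators, second coordinates denominators. -}

module Defs where

open import Data.Nat using (ℕ; zero; suc; _+_; _*_; _≤_)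
open import Data.Integer using (+_)
open import Data.Rational using (ℚ; 0ℚ; 1ℚ; _/_; ↧ₙ_) renaming (_+_ to _+ℚ_; _*_ to _*ℚ_; _<_ to _<ℚ_)
open import Data.List using (List; []; _∷_)
open import Data.List.Relation.Unary.All using (All)
open import Data.Product using (Σ; ∃; _×_; _,_)
open import Data.Sum using (_⊎_)
open import Relation.Binary.PropositionalEquality using (_≡_)

In4Zplus : ℕ → Set
In4Zplus a = ∃ λ k → a ≡ 4 * suc k

-- CFValue as r : the finite continued fraction [0; a₁, …, aₙ] (as = a₁ ∷ … ∷ aₙ ∷ [])
-- has value r.  [0;] = 0 and [0; a, rest] = 1 / (a + [0; rest]), stated
-- division-free as  r * (a + [0; rest]) = 1.
data CFValue : List ℕ → ℚ → Set where
  cf-nil  : CFValue [] 0ℚ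
  cf-cons : ∀ {a as r s} → CFValue as s → r *ℚ ((+ a / 1) +ℚ s) ≡ 1ℚ → CFValue (a ∷ as) r

InS : ℕ → Set
InS m = Σ ℚ λ r → (0ℚ <ℚ r) × (r <ℚ 1ℚ)
          × (∃ λ as → All In4Zplus as × CFValue as r)
          × (↧ₙ r ≡ m)

record Mat2 : Set where
  constructor mat
  field a b c d : ℕ

_·_ : Mat2 → Mat2 → Mat2
mat a b c d · mat a' b' c' d' = mat (a * a' + b * c') (a * b' + b * d') (c * a' + d * c') (c * b' + d * d')

I₂ : Mat2
I₂ = mat 1 0 0 1

U4 : Mat2
U4 = mat 1 4 0 1

L4 : Mat2
L4 = mat 1 0 4 1

data InΨ₂ : Mat2 → Set where
  ψ-id : InΨ₂ I₂
  ψ-U  : ∀ {γ} → InΨ₂ γ → InΨ₂ (γ · U4)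
  ψ-L  : ∀ {γ} → InΨ₂ γ → InΨ₂ (γ · L4)

apply01 : Mat2 → ℕ × ℕ
apply01 (mat a b c d) = (a * 0 + b * 1 , c * 0 + d * 1)

OrbitNumerator : ℕ → Set
OrbitNumerator n = Σ Mat2 λ γ → InΨ₂ γ × Σ ℕ λ q → apply01 γ ≡ (n , q)

OrbitDenominator : ℕ → Set
OrbitDenominator q = Σ Mat2 λ γ → InΨ₂ γ × Σ ℕ λ n → apply01 γ ≡ (n , q)

-- Prepending a to [0; as] sends the pair of continuants (p , q) to (q , a q + p).
-- For a = 4k this is k applications of U4 to (p , q), or of L4 to (q , p); so, up
-- to swapping the coordinates, the continuants of lists over 4ℤ⁺ are exactly the
-- orbit Ψ₂ (0 , 1), a run of k equal generators making one partial quotient 4k.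
-- Since q / (a q + p) is in lowest terms and lies in (0 , 1), its denominator
-- a q + p is the element of S, and every m ≥ 2 in the orbit arises this way.
module Submission where

open import Defs
open import Data.Nat using (ℕ; _≤_)
open import Data.Product using (_×_)
open import Data.Sum using (_⊎_)
open import Function.Bundles using (_⇔_; mk⇔; Equivalence)

open import Data.Nat as ℕ using (suc; _+_; _*_; _<_; s≤s; z≤n; NonZero; >-nonZero; >-nonZero⁻¹)
import Data.Nat.Properties as ℕ
open import Data.Nat.Coprimality using (Coprime; 1-coprimeTo) renaming (sym to coprime-sym)
open import Data.Nat.Divisibility using (∣m+n∣m⇒∣n; ∣n⇒∣m*n)
open import Data.Nat.Tactic.RingSolver using (solve-∀)
open import Data.Integer as ℤ using (+_)
import Data.Integer.Properties as ℤ
import Data.Integer.Tactic.RingSolver as ℤ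
open import Data.Rational using (mkℚ; mkℚ+; 0ℚ; 1ℚ; _/_; ↧ₙ_; toℚᵘ; *<*)
  renaming (_+_ to _+ℚ_; _*_ to _*ℚ_; _<_ to _<ℚ_)
open import Data.Rational.Properties
  using (toℚᵘ-injective; toℚᵘ-homo-*; toℚᵘ-homo-+; toℚᵘ-fromℚᵘ; *-identityˡ; *-identityʳ; *-assoc; *-comm)
open import Data.Rational.Unnormalised as ℚᵘ using (mkℚᵘ; *≡*)
import Data.Rational.Unnormalised.Properties as ℚᵘ
open import Data.List using (List; []; _∷_)
open import Data.List.Relation.Unary.All as All using (All; []; _∷_)
open import Data.Product using (∃; _,_; proj₁; proj₂; swap)
open import Data.Sum using (inj₁; inj₂)
open import Relation.Binary.PropositionalEquality

↧ₙ-mkℚ+ : ∀ n d .{{_ : NonZero d}} .{c : Coprime n d} → ↧ₙ mkℚ+ n d c ≡ d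
↧ₙ-mkℚ+ n (suc d) = refl

0<mkℚ+ : ∀ n d .{{_ : NonZero d}} .{c : Coprime n d} → 0 < n → 0ℚ <ℚ mkℚ+ n d c
0<mkℚ+ (suc n) (suc d) _ = *<* (ℤ.+<+ (s≤s z≤n))

mkℚ+<1 : ∀ n d .{{_ : NonZero d}} .{c : Coprime n d} → n < d → mkℚ+ n d c <ℚ 1ℚ
mkℚ+<1 n (suc d) n<d =
  *<* (subst₂ ℤ._<_ (sym (ℤ.*-identityʳ (+ n))) (sym (ℤ.*-identityˡ (+ suc d))) (ℤ.+<+ n<d))

0<r<1⇒2≤↧ₙ : ∀ {r} → 0ℚ <ℚ r → r <ℚ 1ℚ → 2 ≤ ↧ₙ r
0<r<1⇒2≤↧ₙ {mkℚ (+ 0)       _ _} (*<* (ℤ.+<+ ())) _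
0<r<1⇒2≤↧ₙ {mkℚ ℤ.-[1+ _ ]  _ _} (*<* ()) _
0<r<1⇒2≤↧ₙ {mkℚ (+ suc n)   d _} _ (*<* (ℤ.+<+ (s≤s n<d))) =
  s≤s (ℕ.≤-trans (s≤s z≤n) (ℕ.≤-trans n<d (ℕ.≤-reflexive (ℕ.+-identityʳ d))))

cfValue-unique : ∀ {as r r′} → CFValue as r → CFValue as r′ → r ≡ r′
cfValue-unique cf-nil cf-nil = refl
cfValue-unique {r = r} {r′} (cf-cons {a = a} {s = t} v r*y≡1) (cf-cons v′ r′*y≡1) with cfValue-unique v v′
... | refl = begin
  r                ≡⟨ *-identityʳ r ⟨
  r *ℚ 1ℚ          ≡⟨ cong (r *ℚ_) (trans (*-comm y r′) r′*y≡1) ⟨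
  r *ℚ (y *ℚ r′)   ≡⟨ *-assoc r y r′ ⟨
  (r *ℚ y) *ℚ r′   ≡⟨ cong (_*ℚ r′) r*y≡1 ⟩
  1ℚ *ℚ r′         ≡⟨ *-identityˡ r′ ⟩
  r′               ∎
  where
  open ≡-Reasoning
  y = + a / 1 +ℚ t

-- For (p , q) = continuants as we have [0; as] = p / q (continuants-value),
-- because [0; a, as] = 1 / (a + p / q) = q / (a q + p).
continuants : List ℕ → ℕ × ℕ
continuants []       = 0 , 1
continuants (a ∷ as) = let (p , q) = continuants as in q , a * q + p

continuants-coprime : ∀ as → let (p , q) = continuants as in Coprime p q
continuants-coprime []       = coprime-sym (1-coprimeTo 0)
continuants-coprime (a ∷ as) (d∣q , d∣aq+p) =
  continuants-coprime as (∣m+n∣m⇒∣n d∣aq+p (∣n⇒∣m*n a d∣q) , d∣q)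

continuants-nonZero : ∀ {as} → All NonZero as → NonZero (proj₂ (continuants as))
continuants-nonZero []                     = _
continuants-nonZero {a ∷ as} (a≢0 ∷ as≢0) =
  >-nonZero (ℕ.<-≤-trans (>-nonZero⁻¹ (a * q)) (ℕ.m≤m+n (a * q) p))
  where
  p = proj₁ (continuants as)
  q = proj₂ (continuants as)
  instance
    aq≢0 : NonZero (a * q)
    aq≢0 = ℕ.m*n≢0 a q {{a≢0}} {{continuants-nonZero as≢0}}

continuants-numerator<denominator : ∀ a {as} → 1 < a → All NonZero as →
  let (p , q) = continuants (a ∷ as) in p < q
continuants-numerator<denominator a {as} 1<a as≢0 =
  ℕ.<-≤-trans (ℕ.m<m*n q a 1<a) (ℕ.≤-trans (ℕ.≤-reflexive (ℕ.*-comm q a)) (ℕ.m≤m+n (a * q) p))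
  where
  p = proj₁ (continuants as)
  q = proj₂ (continuants as)
  instance
    q≢0 : NonZero q
    q≢0 = continuants-nonZero as≢0

mkℚ+-continuant-step : ∀ a p q d .{{_ : NonZero q}} .{{_ : NonZero d}} .{c : Coprime q d} .{c′ : Coprime p q} →
  d ≡ a * q + p → mkℚ+ q d c *ℚ (+ a / 1 +ℚ mkℚ+ p q c′) ≡ 1ℚ
mkℚ+-continuant-step a p q@(suc q-1) d@(suc d-1) d≡aq+p = toℚᵘ-injective unnormalised
  where
  r = mkℚ+ q d _
  x = + a / 1
  s = mkℚ+ p q _

  aq+p≡d : + a ℤ.* + q ℤ.+ + p ≡ + d
  aq+p≡d = sym (trans (cong +_ d≡aq+p) (trans (ℤ.pos-+ (a * q) p) (cong (ℤ._+ + p) (ℤ.pos-* a q))))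

  regroup : ∀ q a p → (q ℤ.* (a ℤ.* q ℤ.+ p ℤ.* + 1)) ℤ.* + 1 ≡ + 1 ℤ.* ((a ℤ.* q ℤ.+ p) ℤ.* (+ 1 ℤ.* q))
  regroup = ℤ.solve-∀

  cross-multiplied : (+ q ℤ.* (+ a ℤ.* + q ℤ.+ + p ℤ.* + 1)) ℤ.* + 1 ≡ + 1 ℤ.* + (d * (1 * q))
  cross-multiplied = begin
    (+ q ℤ.* (+ a ℤ.* + q ℤ.+ + p ℤ.* + 1)) ℤ.* + 1   ≡⟨ regroup (+ q) (+ a) (+ p) ⟩
    + 1 ℤ.* ((+ a ℤ.* + q ℤ.+ + p) ℤ.* (+ 1 ℤ.* + q))  ≡⟨ cong (λ z → + 1 ℤ.* (z ℤ.* (+ 1 ℤ.* + q))) aq+p≡d ⟩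
    + 1 ℤ.* (+ d ℤ.* (+ 1 ℤ.* + q))                    ≡⟨ cong (λ z → + 1 ℤ.* (+ d ℤ.* z)) (ℤ.pos-* 1 q) ⟨
    + 1 ℤ.* (+ d ℤ.* + (1 * q))                        ≡⟨ cong (+ 1 ℤ.*_) (ℤ.pos-* d (1 * q)) ⟨
    + 1 ℤ.* + (d * (1 * q))                            ∎
    where open ≡-Reasoning

  unnormalised : toℚᵘ (r *ℚ (x +ℚ s)) ℚᵘ.≃ ℚᵘ.1ℚᵘ
  unnormalised = begin
    toℚᵘ (r *ℚ (x +ℚ s))                                     ≈⟨ toℚᵘ-homo-* r (x +ℚ s) ⟩
    toℚᵘ r ℚᵘ.* toℚᵘ (x +ℚ s)                                ≈⟨ ℚᵘ.*-congˡ {toℚᵘ r} (toℚᵘ-homo-+ x s) ⟩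
    toℚᵘ r ℚᵘ.* (toℚᵘ x ℚᵘ.+ toℚᵘ s)                         ≈⟨ ℚᵘ.*-congˡ {toℚᵘ r} (ℚᵘ.+-congˡ (toℚᵘ s) (toℚᵘ-fromℚᵘ (mkℚᵘ (+ a) 0))) ⟩
    mkℚᵘ (+ q) d-1 ℚᵘ.* (mkℚᵘ (+ a) 0 ℚᵘ.+ mkℚᵘ (+ p) q-1)  ≈⟨ *≡* cross-multiplied ⟩
    ℚᵘ.1ℚᵘ                                                   ∎
    where open ℚᵘ.≃-Reasoning

continuants-value : ∀ {as} (as≢0 : All NonZero as) →
  let (p , q) = continuants as in CFValue as (mkℚ+ p q {{continuants-nonZero as≢0}} (continuants-coprime as))
continuants-value []                     = cf-nil
continuants-value {a ∷ as} (a≢0 ∷ as≢0) =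
  cf-cons (continuants-value as≢0)
          (mkℚ+-continuant-step a p q (a * q + p)
             {{continuants-nonZero as≢0}} {{continuants-nonZero (a≢0 ∷ as≢0)}} refl)
  where
  p = proj₁ (continuants as)
  q = proj₂ (continuants as)

infixr 7 _⊙_

_⊙_ : Mat2 → ℕ × ℕ → ℕ × ℕ
mat a b c d ⊙ (x , y) = a * x + b * y , c * x + d * y

I₂-⊙ : ∀ v → I₂ ⊙ v ≡ v
I₂-⊙ (x , y) = cong₂ _,_ (first x y) (second x y)
  where
  first : ∀ x y → 1 * x + 0 * y ≡ x
  first = solve-∀
  second : ∀ x y → 0 * x + 1 * y ≡ y
  second = solve-∀

·U4-⊙ : ∀ γ b d → (γ · U4) ⊙ (b , d) ≡ γ ⊙ (4 * d + b , d)
·U4-⊙ (mat p q r s) b d = cong₂ _,_ (row p q b d) (row r s b d)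
  where
  row : ∀ p q b d → (p * 1 + q * 0) * b + (p * 4 + q * 1) * d ≡ p * (4 * d + b) + q * d
  row = solve-∀

·L4-⊙ : ∀ γ b d → (γ · L4) ⊙ (b , d) ≡ γ ⊙ (b , 4 * b + d)
·L4-⊙ (mat p q r s) b d = cong₂ _,_ (row p q b d) (row r s b d)
  where
  row : ∀ p q b d → (p * 1 + q * 4) * b + (p * 0 + q * 1) * d ≡ p * b + q * (4 * b + d)
  row = solve-∀

-- The orbit Ψ₂ (0 , 1), with U4 and L4 acting on the left.  InΨ₂ multiplies
-- them on the right, which is why the two lemmas comparing the two descriptions
-- generalise over the vector acted upon and over an accumulated prefix α.
data Orbit : ℕ × ℕ → Set where
  orbit-0,1 : Orbit (0 , 1)
  orbit-U   : ∀ {b d} → Orbit (b , d) → Orbit (4 * d + b , d)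
  orbit-L   : ∀ {b d} → Orbit (b , d) → Orbit (b , 4 * b + d)

Ψ₂-⊙-Orbit : ∀ {γ v} → InΨ₂ γ → Orbit v → Orbit (γ ⊙ v)
Ψ₂-⊙-Orbit {v = v}     ψ-id        o = subst Orbit (sym (I₂-⊙ v)) o
Ψ₂-⊙-Orbit {v = b , d} (ψ-U {γ} h) o = subst Orbit (sym (·U4-⊙ γ b d)) (Ψ₂-⊙-Orbit h (orbit-U o))
Ψ₂-⊙-Orbit {v = b , d} (ψ-L {γ} h) o = subst Orbit (sym (·L4-⊙ γ b d)) (Ψ₂-⊙-Orbit h (orbit-L o))

Ψ₂-⊙-Orbit-witness : ∀ {α v} → InΨ₂ α → Orbit v → ∃ λ γ → InΨ₂ γ × γ ⊙ (0 , 1) ≡ α ⊙ v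
Ψ₂-⊙-Orbit-witness     h orbit-0,1           = _ , h , refl
Ψ₂-⊙-Orbit-witness {α} h (orbit-U {b} {d} o) =
  let γ , h′ , e = Ψ₂-⊙-Orbit-witness (ψ-U h) o in γ , h′ , trans e (·U4-⊙ α b d)
Ψ₂-⊙-Orbit-witness {α} h (orbit-L {b} {d} o) =
  let γ , h′ , e = Ψ₂-⊙-Orbit-witness (ψ-L h) o in γ , h′ , trans e (·L4-⊙ α b d)

OrbitUpToSwap : ℕ × ℕ → Set
OrbitUpToSwap v = Orbit v ⊎ Orbit (swap v)

orbitCoordinate⇔OrbitUpToSwap : ∀ {m} → (OrbitNumerator m ⊎ OrbitDenominator m) ⇔ ∃ λ x → OrbitUpToSwap (x , m)
orbitCoordinate⇔OrbitUpToSwap {m} = mk⇔ to from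
  where
  to : OrbitNumerator m ⊎ OrbitDenominator m → ∃ λ x → OrbitUpToSwap (x , m)
  to (inj₁ (γ , h , q , e)) = q , inj₂ (subst Orbit e (Ψ₂-⊙-Orbit h orbit-0,1))
  to (inj₂ (γ , h , n , e)) = n , inj₁ (subst Orbit e (Ψ₂-⊙-Orbit h orbit-0,1))

  from : ∃ (λ x → OrbitUpToSwap (x , m)) → OrbitNumerator m ⊎ OrbitDenominator m
  from (x , inj₁ o) = let γ , h , e = Ψ₂-⊙-Orbit-witness ψ-id o in inj₂ (γ , h , x , trans e (I₂-⊙ _))
  from (x , inj₂ o) = let γ , h , e = Ψ₂-⊙-Orbit-witness ψ-id o in inj₁ (γ , h , x , trans e (I₂-⊙ _))

In4Zplus-4 : In4Zplus 4
In4Zplus-4 = 0 , refl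

In4Zplus-4+ : ∀ {a} → In4Zplus a → In4Zplus (4 + a)
In4Zplus-4+ (k , refl) = suc k , sym (ℕ.*-suc 4 (suc k))

In4Zplus⇒NonZero : ∀ {a} → In4Zplus a → NonZero a
In4Zplus⇒NonZero (k , refl) = _

In4Zplus⇒1< : ∀ {a} → In4Zplus a → 1 < a
In4Zplus⇒1< (k , refl) = ℕ.≤-trans (s≤s (s≤s z≤n)) (ℕ.*-monoʳ-≤ 4 (s≤s z≤n))

orbit-U^ : ∀ n {b d} → Orbit (b , d) → Orbit (4 * n * d + b , d)
orbit-U^ 0               o = o
orbit-U^ (suc n) {b} {d} o = subst (λ x → Orbit (x , d)) (expand n b d) (orbit-U (orbit-U^ n o))
  where
  expand : ∀ n b d → 4 * d + (4 * n * d + b) ≡ 4 * suc n * d + b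
  expand = solve-∀

orbit-L^ : ∀ n {b d} → Orbit (b , d) → Orbit (b , 4 * n * b + d)
orbit-L^ 0               o = o
orbit-L^ (suc n) {b} {d} o = subst (λ y → Orbit (b , y)) (expand n b d) (orbit-L (orbit-L^ n o))
  where
  expand : ∀ n b d → 4 * b + (4 * n * b + d) ≡ 4 * suc n * b + d
  expand = solve-∀

continuants-OrbitUpToSwap : ∀ {as} → All In4Zplus as → OrbitUpToSwap (continuants as)
continuants-OrbitUpToSwap []                 = inj₁ orbit-0,1
continuants-OrbitUpToSwap ((k , refl) ∷ as∈) with continuants-OrbitUpToSwap as∈
... | inj₁ o = inj₂ (orbit-U^ (suc k) o)
... | inj₂ o = inj₁ (orbit-L^ (suc k) o)

continuants-4+ : ∀ a as {x y} → continuants (a ∷ as) ≡ (x , y) → continuants (4 + a ∷ as) ≡ (x , 4 * x + y)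
continuants-4+ a as refl = cong (q ,_) (expand a q p)
  where
  p = proj₁ (continuants as)
  q = proj₂ (continuants as)
  expand : ∀ a q p → (4 + a) * q + p ≡ 4 * q + (a * q + p)
  expand = solve-∀

-- Repeating the generator that produced the leading partial quotient adds 4 to
-- it instead of prepending a new one; the [] cases are (1 , 0) and (0 , 1),
-- which are fixed by U4 and L4 respectively.
Orbit-continuants : ∀ {v} → Orbit v → ∃ λ as → All In4Zplus as × (continuants as ≡ v ⊎ continuants as ≡ swap v)
Orbit-continuants orbit-0,1 = [] , [] , inj₁ refl
Orbit-continuants (orbit-U o) with Orbit-continuants o
... | as     , as∈      , inj₁ refl = 4 ∷ as , In4Zplus-4 ∷ as∈ , inj₂ refl
... | []     , []       , inj₂ refl = [] , [] , inj₂ refl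
... | a ∷ as , a∈ ∷ as∈ , inj₂ e    = 4 + a ∷ as , In4Zplus-4+ a∈ ∷ as∈ , inj₂ (continuants-4+ a as e)
Orbit-continuants (orbit-L o) with Orbit-continuants o
... | as     , as∈      , inj₂ refl = 4 ∷ as , In4Zplus-4 ∷ as∈ , inj₁ refl
... | []     , []       , inj₁ refl = [] , [] , inj₁ refl
... | a ∷ as , a∈ ∷ as∈ , inj₁ e    = 4 + a ∷ as , In4Zplus-4+ a∈ ∷ as∈ , inj₁ (continuants-4+ a as e)

CFDenominator : ℕ → Set
CFDenominator m = ∃ λ as → All In4Zplus as × proj₂ (continuants as) ≡ m

InS⇒CFDenominator : ∀ {m} → InS m → CFDenominator m
InS⇒CFDenominator (r , _ , _ , (as , as∈ , r-cf) , refl) =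
  as , as∈ , sym (trans (cong ↧ₙ_ (cfValue-unique r-cf (continuants-value as≢0)))
                        (↧ₙ-mkℚ+ _ _ {{continuants-nonZero as≢0}}))
  where
  as≢0 = All.map In4Zplus⇒NonZero as∈

InS⇒2≤ : ∀ {m} → InS m → 2 ≤ m
InS⇒2≤ (_ , 0<r , r<1 , _ , refl) = 0<r<1⇒2≤↧ₙ 0<r r<1

CFDenominator⇒InS : ∀ {m} → CFDenominator m → 2 ≤ m → InS m
CFDenominator⇒InS ([] , _ , refl) (s≤s ())
CFDenominator⇒InS (a ∷ as , a∷as∈@(a∈ ∷ as∈) , refl) _ =
  r , 0<mkℚ+ q d (>-nonZero⁻¹ q) , mkℚ+<1 q d q<d , (a ∷ as , a∷as∈ , continuants-value a∷as≢0) , ↧ₙ-mkℚ+ q d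
  where
  as≢0   = All.map In4Zplus⇒NonZero as∈
  a∷as≢0 = All.map In4Zplus⇒NonZero a∷as∈
  p = proj₁ (continuants as)
  q = proj₂ (continuants as)
  d = a * q + p
  instance
    q≢0 : NonZero q
    q≢0 = continuants-nonZero as≢0
    d≢0 : NonZero d
    d≢0 = continuants-nonZero a∷as≢0
  r = mkℚ+ q d (continuants-coprime (a ∷ as))
  q<d = continuants-numerator<denominator a (In4Zplus⇒1< a∈) as≢0

CFDenominator⇒OrbitUpToSwap : ∀ {m} → CFDenominator m → ∃ λ x → OrbitUpToSwap (x , m)
CFDenominator⇒OrbitUpToSwap (_ , as∈ , refl) = _ , continuants-OrbitUpToSwap as∈

numerator⇒CFDenominator : ∀ {as m} → All In4Zplus as → proj₁ (continuants as) ≡ m → 0 < m → CFDenominator m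
numerator⇒CFDenominator []                refl ()
numerator⇒CFDenominator {_ ∷ as} (_ ∷ as∈) e    _ = as , as∈ , e

OrbitUpToSwap⇒CFDenominator : ∀ {m} → 0 < m → ∃ (λ x → OrbitUpToSwap (x , m)) → CFDenominator m
OrbitUpToSwap⇒CFDenominator 0<m (x , inj₁ o) with Orbit-continuants o
... | as , as∈ , inj₁ e = as , as∈ , cong proj₂ e
... | as , as∈ , inj₂ e = numerator⇒CFDenominator as∈ (cong proj₁ e) 0<m
OrbitUpToSwap⇒CFDenominator 0<m (x , inj₂ o) with Orbit-continuants o
... | as , as∈ , inj₁ e = numerator⇒CFDenominator as∈ (cong proj₁ e) 0<m
... | as , as∈ , inj₂ e = as , as∈ , cong proj₂ e

corollary2p16 : (m : ℕ) → InS m ⇔ ((OrbitNumerator m ⊎ OrbitDenominator m) × 2 ≤ m)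
corollary2p16 m = mk⇔
  (λ m∈S → from orbitCoordinate⇔OrbitUpToSwap (CFDenominator⇒OrbitUpToSwap (InS⇒CFDenominator m∈S)) ,
           InS⇒2≤ m∈S)
  (λ (m∈orbit , 2≤m) →
     let 0<m = ℕ.≤-trans (s≤s z≤n) 2≤m in
     CFDenominator⇒InS (OrbitUpToSwap⇒CFDenominator 0<m (to orbitCoordinate⇔OrbitUpToSwap m∈orbit)) 2≤m)
  where open Equivalence
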